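{- Let $X$ and $Y$ be $n\times n$ matrices over a field, where $Y$ is strictly upper triangular. Define $X^{(0)}=X$ and $X^{(i)}=X^{(i-1)}+X^{(i-1)}_{*,i}\cdot Y_{i,*}$ for $1\le i\le n$, and let $X\otimes Y$ denote $X^{(n)}$. Then $X\otimes Y=X\cdot(I-Y)^{ -1}$.
   Context: $A_{*,i}$ denotes the $i$-th column of a matrix $A$ and $A_{i,*}$ its $i$-th row; $I$ is the $n\times n$ identity matrix. -}

module Defs where

open import Level using (Level; _⊔_; suc)
open import Data.Nat using (ℕ)
open import Data.Fin using (Fin; _<_; _≟_)
open import Data.List using (List; foldl; allFin)
open import Data.Product using (Σ; _×_)
open import Relation.Nullary using (¬_; yes; no)
open import Algebra.Bundles using (CommutativeRing)
import Algebra.Properties.CommutativeMonoid.Sum as Sum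

record Field (c ℓ : Level) : Set (suc (c ⊔ ℓ)) where
  field
    commutativeRing : CommutativeRing c ℓ
  open CommutativeRing commutativeRing public
  field
    0≉1     : ¬ (0# ≈ 1#)
    inverse : ∀ x → ¬ (x ≈ 0#) → Σ Carrier λ y → (x * y) ≈ 1#

module Matrices {c ℓ : Level} (F : Field c ℓ) where
  open Field F
  open Sum +-commutativeMonoid using (sum)

  -- n × n matrices over F, entries indexed (row, column)
  Matrix : ℕ → Set c
  Matrix n = Fin n → Fin n → Carrier

  _≈ᴹ_ : ∀ {n} → Matrix n → Matrix n → Set ℓ
  A ≈ᴹ B = ∀ i j → A i j ≈ B i j

  _*ᴹ_ : ∀ {n} → Matrix n → Matrix n → Matrix n
  (A *ᴹ B) i j = sum (λ k → A i k * B k j)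

  _-ᴹ_ : ∀ {n} → Matrix n → Matrix n → Matrix n
  (A -ᴹ B) i j = A i j - B i j

  I : ∀ {n} → Matrix n
  I i j with i ≟ j
  ... | yes _ = 1#
  ... | no  _ = 0#

  StrictlyUpperTriangular : ∀ {n} → Matrix n → Set ℓ
  StrictlyUpperTriangular Y = ∀ i j → ¬ (i < j) → Y i j ≈ 0#

  IsInverse : ∀ {n} → Matrix n → Matrix n → Set ℓ
  IsInverse A B = ((A *ᴹ B) ≈ᴹ I) × ((B *ᴹ A) ≈ᴹ I)

  step : ∀ {n} → Matrix n → Matrix n → Fin n → Matrix n
  step Y M i r s = M r s + M r i * Y i s

  -- X ⊗ Y = X^(n): apply the steps for columns 1,…,n (Fin indices 0,…,n-1) in order
  _⊗_ : ∀ {n} → Matrix n → Matrix n → Matrix n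
  _⊗_ {n} X Y = foldl (step Y) X (allFin n)

-- Write E k = I_{*,k} · Y_{k,*} (onlyRow k), the matrix whose only nonzero row is row k of Y,
-- and D t (firstRows t) for Y with every row of index ≥ t replaced by zero.  The k-th step is
-- right multiplication by I + E k, so X ⊗ Y = X · (I ⊗ Y) with I ⊗ Y = (I + E 0) ⋯ (I + E (n-1)).
-- As Y is strictly upper triangular, E k · E k = 0, so I + E k inverts I - E k; and E k · D k = 0,
-- so (I - E k)(I - D k) = I - D (k+1).  Hence the product of the first t factors inverts
-- I - D t, and D n = Y.
module Submission where

open import Defs
open import Level using (Level)
open import Data.Nat using (ℕ; suc)
import Data.Nat as ℕ
import Data.Nat.Properties as ℕₚ
open import Data.Fin using (Fin; toℕ; punchIn; _≟_)
import Data.Fin as Fin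
open import Data.Fin.Properties using (<-cmp; toℕ<n; punchInᵢ≢i)
open import Data.List using ([]; _∷_; foldl; tabulate; allFin)
open import Data.Product using (Σ; _×_; _,_)
open import Function using (id; _∘_)
open import Relation.Binary using (Setoid; tri<; tri≈; tri>)
open import Relation.Binary.PropositionalEquality as ≡ using (_≡_; _≢_)
open import Relation.Nullary using (¬_; yes; no; contradiction)
import Algebra.Properties.Semiring.Sum as SemiringSum
import Algebra.Properties.Ring as RingProperties
import Algebra.Properties.Group as GroupProperties
import Relation.Binary.Reasoning.Setoid as SetoidReasoning

module MatrixProperties {c ℓ : Level} (F : Field c ℓ) where
  open Field F hiding (zero)
  open Matrices F
  open SemiringSum semiring
    using (sum; sum-cong-≋; sum-replicate-zero; sum-remove; ∑-distrib-+; ∑-comm; *-distribˡ-sum; *-distribʳ-sum)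
  open RingProperties ring using (-1*x≈-x; x[y-z]≈xy-xz; [y-z]x≈yx-zx)
  open GroupProperties +-group using (ε⁻¹≈ε; ⁻¹-anti-homo-∙; //-rightDividesˡ; //-rightDividesʳ)

  x-0≈x : ∀ {x z} → z ≈ 0# → x - z ≈ x
  x-0≈x {x} z≈0 = trans (+-congˡ (trans (-‿cong z≈0) ε⁻¹≈ε)) (+-identityʳ x)

  sum-zero : ∀ {n} (f : Fin n → Carrier) → (∀ j → f j ≈ 0#) → sum f ≈ 0#
  sum-zero {n} f f≈0 = trans (sum-cong-≋ f≈0) (sum-replicate-zero n)

  sum-single : ∀ {n} (f : Fin n → Carrier) i → (∀ j → j ≢ i → f j ≈ 0#) → sum f ≈ f i
  sum-single {suc n} f i f≈0 = begin
    sum f                            ≈⟨ sum-remove f ⟩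
    f i + sum (f ∘ punchIn i)        ≈⟨ +-congˡ (sum-zero _ (λ j → f≈0 (punchIn i j) (punchInᵢ≢i i j))) ⟩
    f i + 0#                         ≈⟨ +-identityʳ (f i) ⟩
    f i                              ∎
    where open SetoidReasoning setoid

  sum-neg : ∀ {n} (g : Fin n → Carrier) → sum (λ j → - g j) ≈ - sum g
  sum-neg g = begin
    sum (λ j → - g j)       ≈⟨ sum-cong-≋ (λ j → sym (-1*x≈-x (g j))) ⟩
    sum (λ j → - 1# * g j)  ≈⟨ sym (*-distribˡ-sum (- 1#) g) ⟩
    - 1# * sum g            ≈⟨ -1*x≈-x (sum g) ⟩
    - sum g                 ∎
    where open SetoidReasoning setoid

  sum-sub : ∀ {n} (f g : Fin n → Carrier) → sum (λ j → f j - g j) ≈ sum f - sum g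
  sum-sub f g = trans (∑-distrib-+ f (λ j → - g j)) (+-congˡ (sum-neg g))

  I-diagonal : ∀ {n} (i : Fin n) → I i i ≈ 1#
  I-diagonal i with i ≟ i
  ... | yes _  = refl
  ... | no i≢i = contradiction ≡.refl i≢i

  I-offDiagonal : ∀ {n} {i j : Fin n} → i ≢ j → I i j ≈ 0#
  I-offDiagonal {i = i} {j} i≢j with i ≟ j
  ... | yes i≡j = contradiction i≡j i≢j
  ... | no _    = refl

  _+ᴹ_ : ∀ {n} → Matrix n → Matrix n → Matrix n
  (A +ᴹ B) i j = A i j + B i j

  0ᴹ : ∀ {n} → Matrix n
  0ᴹ i j = 0#

  ≈ᴹ-setoid : ℕ → Setoid c ℓ
  ≈ᴹ-setoid n = record
    { Carrier       = Matrix n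
    ; _≈_           = _≈ᴹ_
    ; isEquivalence = record
      { refl  = λ i j → refl
      ; sym   = λ A≈B i j → sym (A≈B i j)
      ; trans = λ A≈B B≈C i j → trans (A≈B i j) (B≈C i j)
      }
    }

  module _ {n : ℕ} where
    open Setoid (≈ᴹ-setoid n) public
      using () renaming (refl to ≈ᴹ-refl; sym to ≈ᴹ-sym; trans to ≈ᴹ-trans)

  *ᴹ-cong : ∀ {n} {A A′ B B′ : Matrix n} → A ≈ᴹ A′ → B ≈ᴹ B′ → (A *ᴹ B) ≈ᴹ (A′ *ᴹ B′)
  *ᴹ-cong A≈A′ B≈B′ i j = sum-cong-≋ (λ k → *-cong (A≈A′ i k) (B≈B′ k j))

  *ᴹ-identityˡ : ∀ {n} (A : Matrix n) → (I *ᴹ A) ≈ᴹ A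
  *ᴹ-identityˡ A i j =
    trans (sum-single _ i (λ k k≢i → trans (*-congʳ (I-offDiagonal (k≢i ∘ ≡.sym))) (zeroˡ (A k j))))
          (trans (*-congʳ (I-diagonal i)) (*-identityˡ (A i j)))

  *ᴹ-identityʳ : ∀ {n} (A : Matrix n) → (A *ᴹ I) ≈ᴹ A
  *ᴹ-identityʳ A i j =
    trans (sum-single _ j (λ k k≢j → trans (*-congˡ (I-offDiagonal k≢j)) (zeroʳ (A i k))))
          (trans (*-congˡ (I-diagonal j)) (*-identityʳ (A i j)))

  *ᴹ-assoc : ∀ {n} (A B C : Matrix n) → ((A *ᴹ B) *ᴹ C) ≈ᴹ (A *ᴹ (B *ᴹ C))
  *ᴹ-assoc A B C i j = begin
    sum (λ k → sum (λ l → A i l * B l k) * C k j)    ≈⟨ sum-cong-≋ (λ k → *-distribʳ-sum (C k j) (λ l → A i l * B l k)) ⟩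
    sum (λ k → sum (λ l → A i l * B l k * C k j))    ≈⟨ ∑-comm (λ k l → A i l * B l k * C k j) ⟩
    sum (λ l → sum (λ k → A i l * B l k * C k j))    ≈⟨ sum-cong-≋ (λ l → sum-cong-≋ (λ k → *-assoc (A i l) (B l k) (C k j))) ⟩
    sum (λ l → sum (λ k → A i l * (B l k * C k j)))  ≈⟨ sum-cong-≋ (λ l → sym (*-distribˡ-sum (A i l) (λ k → B l k * C k j))) ⟩
    sum (λ l → A i l * sum (λ k → B l k * C k j))    ∎
    where open SetoidReasoning setoid

  *ᴹ-distribˡ-+ᴹ : ∀ {n} (A B C : Matrix n) → (A *ᴹ (B +ᴹ C)) ≈ᴹ ((A *ᴹ B) +ᴹ (A *ᴹ C))
  *ᴹ-distribˡ-+ᴹ A B C i j =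
    trans (sum-cong-≋ (λ k → distribˡ (A i k) (B k j) (C k j)))
          (∑-distrib-+ (λ k → A i k * B k j) (λ k → A i k * C k j))

  *ᴹ-distribʳ-+ᴹ : ∀ {n} (A B C : Matrix n) → ((A +ᴹ B) *ᴹ C) ≈ᴹ ((A *ᴹ C) +ᴹ (B *ᴹ C))
  *ᴹ-distribʳ-+ᴹ A B C i j =
    trans (sum-cong-≋ (λ k → distribʳ (C k j) (A i k) (B i k)))
          (∑-distrib-+ (λ k → A i k * C k j) (λ k → B i k * C k j))

  A[B-C]≈AB-AC : ∀ {n} (A B C : Matrix n) → (A *ᴹ (B -ᴹ C)) ≈ᴹ ((A *ᴹ B) -ᴹ (A *ᴹ C))
  A[B-C]≈AB-AC A B C i j =
    trans (sum-cong-≋ (λ k → x[y-z]≈xy-xz (A i k) (B k j) (C k j)))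
          (sum-sub (λ k → A i k * B k j) (λ k → A i k * C k j))

  [A-B]C≈AC-BC : ∀ {n} (A B C : Matrix n) → ((A -ᴹ B) *ᴹ C) ≈ᴹ ((A *ᴹ C) -ᴹ (B *ᴹ C))
  [A-B]C≈AC-BC A B C i j =
    trans (sum-cong-≋ (λ k → [y-z]x≈yx-zx (C k j) (A i k) (B i k)))
          (sum-sub (λ k → A i k * C k j) (λ k → B i k * C k j))

  IsInverse-resp-≈ᴹ : ∀ {n} {A A′ B B′ : Matrix n} → A ≈ᴹ A′ → B ≈ᴹ B′ → IsInverse A B → IsInverse A′ B′
  IsInverse-resp-≈ᴹ A≈A′ B≈B′ (AB≈I , BA≈I) =
    ≈ᴹ-trans (*ᴹ-cong (≈ᴹ-sym A≈A′) (≈ᴹ-sym B≈B′)) AB≈I ,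
    ≈ᴹ-trans (*ᴹ-cong (≈ᴹ-sym B≈B′) (≈ᴹ-sym A≈A′)) BA≈I

  IsInverse-*ᴹ : ∀ {n} {A A′ B B′ : Matrix n} → IsInverse A A′ → IsInverse B B′ → IsInverse (B *ᴹ A) (A′ *ᴹ B′)
  IsInverse-*ᴹ {A = A} {A′} {B} {B′} (AA′≈I , A′A≈I) (BB′≈I , B′B≈I) = left , right
    where
    open SetoidReasoning (≈ᴹ-setoid _)
    left : ((B *ᴹ A) *ᴹ (A′ *ᴹ B′)) ≈ᴹ I
    left = begin
      (B *ᴹ A) *ᴹ (A′ *ᴹ B′)    ≈⟨ *ᴹ-assoc B A (A′ *ᴹ B′) ⟩
      B *ᴹ (A *ᴹ (A′ *ᴹ B′))    ≈⟨ *ᴹ-cong ≈ᴹ-refl (≈ᴹ-sym (*ᴹ-assoc A A′ B′)) ⟩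
      B *ᴹ ((A *ᴹ A′) *ᴹ B′)    ≈⟨ *ᴹ-cong ≈ᴹ-refl (≈ᴹ-trans (*ᴹ-cong AA′≈I ≈ᴹ-refl) (*ᴹ-identityˡ B′)) ⟩
      B *ᴹ B′                   ≈⟨ BB′≈I ⟩
      I                         ∎
    right : ((A′ *ᴹ B′) *ᴹ (B *ᴹ A)) ≈ᴹ I
    right = begin
      (A′ *ᴹ B′) *ᴹ (B *ᴹ A)    ≈⟨ *ᴹ-assoc A′ B′ (B *ᴹ A) ⟩
      A′ *ᴹ (B′ *ᴹ (B *ᴹ A))    ≈⟨ *ᴹ-cong ≈ᴹ-refl (≈ᴹ-sym (*ᴹ-assoc B′ B A)) ⟩
      A′ *ᴹ ((B′ *ᴹ B) *ᴹ A)    ≈⟨ *ᴹ-cong ≈ᴹ-refl (≈ᴹ-trans (*ᴹ-cong B′B≈I ≈ᴹ-refl) (*ᴹ-identityˡ A)) ⟩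
      A′ *ᴹ A                   ≈⟨ A′A≈I ⟩
      I                         ∎

  inverse-unique : ∀ {n} {A B C : Matrix n} → IsInverse A B → IsInverse A C → B ≈ᴹ C
  inverse-unique {A = A} {B} {C} (_ , BA≈I) (AC≈I , _) = begin
    B                ≈⟨ ≈ᴹ-sym (*ᴹ-identityʳ B) ⟩
    B *ᴹ I           ≈⟨ *ᴹ-cong ≈ᴹ-refl (≈ᴹ-sym AC≈I) ⟩
    B *ᴹ (A *ᴹ C)    ≈⟨ ≈ᴹ-sym (*ᴹ-assoc B A C) ⟩
    (B *ᴹ A) *ᴹ C    ≈⟨ *ᴹ-cong BA≈I ≈ᴹ-refl ⟩
    I *ᴹ C           ≈⟨ *ᴹ-identityˡ C ⟩
    C                ∎
    where open SetoidReasoning (≈ᴹ-setoid _)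

  I-E-inverse-I+E : ∀ {n} {E : Matrix n} → (E *ᴹ E) ≈ᴹ 0ᴹ → IsInverse (I -ᴹ E) (I +ᴹ E)
  I-E-inverse-I+E {E = E} E²≈0 = left , right
    where
    open SetoidReasoning setoid
    left : ((I -ᴹ E) *ᴹ (I +ᴹ E)) ≈ᴹ I
    left r s = begin
      ((I -ᴹ E) *ᴹ (I +ᴹ E)) r s                        ≈⟨ *ᴹ-distribˡ-+ᴹ (I -ᴹ E) I E r s ⟩
      ((I -ᴹ E) *ᴹ I) r s + ((I -ᴹ E) *ᴹ E) r s         ≈⟨ +-cong (*ᴹ-identityʳ (I -ᴹ E) r s) ([A-B]C≈AC-BC I E E r s) ⟩
      (I r s - E r s) + ((I *ᴹ E) r s - (E *ᴹ E) r s)   ≈⟨ +-congˡ (trans (x-0≈x (E²≈0 r s)) (*ᴹ-identityˡ E r s)) ⟩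
      (I r s - E r s) + E r s                           ≈⟨ //-rightDividesˡ (E r s) (I r s) ⟩
      I r s                                             ∎
    right : ((I +ᴹ E) *ᴹ (I -ᴹ E)) ≈ᴹ I
    right r s = begin
      ((I +ᴹ E) *ᴹ (I -ᴹ E)) r s                        ≈⟨ A[B-C]≈AB-AC (I +ᴹ E) I E r s ⟩
      ((I +ᴹ E) *ᴹ I) r s - ((I +ᴹ E) *ᴹ E) r s         ≈⟨ +-cong (*ᴹ-identityʳ (I +ᴹ E) r s) (-‿cong (*ᴹ-distribʳ-+ᴹ I E E r s)) ⟩
      (I r s + E r s) - ((I *ᴹ E) r s + (E *ᴹ E) r s)   ≈⟨ +-congˡ (-‿cong (+-cong (*ᴹ-identityˡ E r s) (E²≈0 r s))) ⟩
      (I r s + E r s) - (E r s + 0#)                    ≈⟨ +-congˡ (-‿cong (+-identityʳ (E r s))) ⟩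
      (I r s + E r s) - E r s                           ≈⟨ //-rightDividesʳ (E r s) (I r s) ⟩
      I r s                                             ∎

  [I-E][I-D]≈I-[D+E] : ∀ {n} {D E : Matrix n} → (E *ᴹ D) ≈ᴹ 0ᴹ → ((I -ᴹ E) *ᴹ (I -ᴹ D)) ≈ᴹ (I -ᴹ (D +ᴹ E))
  [I-E][I-D]≈I-[D+E] {D = D} {E} ED≈0 r s = begin
    ((I -ᴹ E) *ᴹ (I -ᴹ D)) r s                        ≈⟨ A[B-C]≈AB-AC (I -ᴹ E) I D r s ⟩
    ((I -ᴹ E) *ᴹ I) r s - ((I -ᴹ E) *ᴹ D) r s         ≈⟨ +-cong (*ᴹ-identityʳ (I -ᴹ E) r s) (-‿cong ([A-B]C≈AC-BC I E D r s)) ⟩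
    (I r s - E r s) - ((I *ᴹ D) r s - (E *ᴹ D) r s)   ≈⟨ +-congˡ (-‿cong (trans (x-0≈x (ED≈0 r s)) (*ᴹ-identityˡ D r s))) ⟩
    (I r s - E r s) - D r s                           ≈⟨ +-assoc (I r s) (- E r s) (- D r s) ⟩
    I r s + (- E r s - D r s)                         ≈⟨ +-congˡ (sym (⁻¹-anti-homo-∙ (D r s) (E r s))) ⟩
    I r s - (D r s + E r s)                           ∎
    where open SetoidReasoning setoid

  module _ {n : ℕ} (Y : Matrix n) where

    onlyRow : Fin n → Matrix n
    onlyRow k r s = I r k * Y k s

    firstRows : ℕ → Matrix n
    firstRows t r s with toℕ r ℕ.<? t
    ... | yes _ = Y r s
    ... | no  _ = 0#

    onlyRow-on : ∀ k s → onlyRow k k s ≈ Y k s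
    onlyRow-on k s = trans (*-congʳ (I-diagonal k)) (*-identityˡ (Y k s))

    onlyRow-off : ∀ {k r} s → r ≢ k → onlyRow k r s ≈ 0#
    onlyRow-off s r≢k = trans (*-congʳ (I-offDiagonal r≢k)) (zeroˡ _)

    *ᴹ-onlyRow : ∀ (M : Matrix n) k r s → (M *ᴹ onlyRow k) r s ≈ M r k * Y k s
    *ᴹ-onlyRow M k r s = begin
      sum (λ j → M r j * (I j k * Y k s))   ≈⟨ sum-cong-≋ (λ j → sym (*-assoc (M r j) (I j k) (Y k s))) ⟩
      sum (λ j → M r j * I j k * Y k s)     ≈⟨ sym (*-distribʳ-sum (Y k s) (λ j → M r j * I j k)) ⟩
      (M *ᴹ I) r k * Y k s                  ≈⟨ *-congʳ (*ᴹ-identityʳ M r k) ⟩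
      M r k * Y k s                         ∎
      where open SetoidReasoning setoid

    onlyRow-*ᴹ-zero : ∀ {B : Matrix n} k → (∀ j s → Y k j * B j s ≈ 0#) → (onlyRow k *ᴹ B) ≈ᴹ 0ᴹ
    onlyRow-*ᴹ-zero {B} k YB≈0 r s =
      sum-zero _ (λ j → trans (*-assoc (I r k) (Y k j) (B j s)) (trans (*-congˡ (YB≈0 j s)) (zeroʳ (I r k))))

    firstRows-below : ∀ {t} r s → toℕ r ℕ.< t → firstRows t r s ≈ Y r s
    firstRows-below {t} r s r<t with toℕ r ℕ.<? t
    ... | yes _   = refl
    ... | no  r≮t = contradiction r<t r≮t

    firstRows-above : ∀ {t} r s → ¬ toℕ r ℕ.< t → firstRows t r s ≈ 0#
    firstRows-above {t} r s r≮t with toℕ r ℕ.<? t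
    ... | yes r<t = contradiction r<t r≮t
    ... | no  _   = refl

    firstRows-suc : ∀ k → firstRows (suc (toℕ k)) ≈ᴹ (firstRows (toℕ k) +ᴹ onlyRow k)
    firstRows-suc k r s with <-cmp r k
    ... | tri< r<k r≢k _ = begin
      firstRows (suc (toℕ k)) r s       ≈⟨ firstRows-below r s (ℕₚ.m<n⇒m<1+n r<k) ⟩
      Y r s                             ≈⟨ sym (+-identityʳ (Y r s)) ⟩
      Y r s + 0#                        ≈⟨ sym (+-cong (firstRows-below r s r<k) (onlyRow-off s r≢k)) ⟩
      firstRows (toℕ k) r s + onlyRow k r s ∎
      where open SetoidReasoning setoid
    ... | tri≈ _ ≡.refl _ = begin
      firstRows (suc (toℕ k)) k s       ≈⟨ firstRows-below k s (ℕₚ.n<1+n (toℕ k)) ⟩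
      Y k s                             ≈⟨ sym (+-identityˡ (Y k s)) ⟩
      0# + Y k s                        ≈⟨ sym (+-cong (firstRows-above k s (ℕₚ.<-irrefl ≡.refl)) (onlyRow-on k s)) ⟩
      firstRows (toℕ k) k s + onlyRow k k s ∎
      where open SetoidReasoning setoid
    ... | tri> _ r≢k k<r = begin
      firstRows (suc (toℕ k)) r s       ≈⟨ firstRows-above r s (ℕₚ.<⇒≱ k<r ∘ ℕₚ.m<1+n⇒m≤n) ⟩
      0#                                ≈⟨ sym (+-identityʳ 0#) ⟩
      0# + 0#                           ≈⟨ sym (+-cong (firstRows-above r s (ℕₚ.<-asym k<r)) (onlyRow-off s r≢k)) ⟩
      firstRows (toℕ k) r s + onlyRow k r s ∎
      where open SetoidReasoning setoid

    firstRows-zero : firstRows 0 ≈ᴹ 0ᴹ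
    firstRows-zero r s = firstRows-above {0} r s (λ ())

    firstRows-all : firstRows n ≈ᴹ Y
    firstRows-all r s = firstRows-below r s (toℕ<n r)

    step≈*ᴹ[I+onlyRow] : ∀ M k → step Y M k ≈ᴹ (M *ᴹ (I +ᴹ onlyRow k))
    step≈*ᴹ[I+onlyRow] M k r s =
      sym (trans (*ᴹ-distribˡ-+ᴹ M I (onlyRow k) r s) (+-cong (*ᴹ-identityʳ M r s) (*ᴹ-onlyRow M k r s)))

    step-cong : ∀ {A B} k → A ≈ᴹ B → step Y A k ≈ᴹ step Y B k
    step-cong k A≈B r s = +-cong (A≈B r s) (*-congʳ (A≈B r k))

    step-*ᴹ : ∀ X A k → step Y (X *ᴹ A) k ≈ᴹ (X *ᴹ step Y A k)
    step-*ᴹ X A k = begin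
      step Y (X *ᴹ A) k                   ≈⟨ step≈*ᴹ[I+onlyRow] (X *ᴹ A) k ⟩
      (X *ᴹ A) *ᴹ (I +ᴹ onlyRow k)        ≈⟨ *ᴹ-assoc X A (I +ᴹ onlyRow k) ⟩
      X *ᴹ (A *ᴹ (I +ᴹ onlyRow k))        ≈⟨ *ᴹ-cong ≈ᴹ-refl (≈ᴹ-sym (step≈*ᴹ[I+onlyRow] A k)) ⟩
      X *ᴹ step Y A k                     ∎
      where open SetoidReasoning (≈ᴹ-setoid n)

    foldl-step-*ᴹ : ∀ ks {M X A} → M ≈ᴹ (X *ᴹ A) → foldl (step Y) M ks ≈ᴹ (X *ᴹ foldl (step Y) A ks)
    foldl-step-*ᴹ []       M≈XA = M≈XA
    foldl-step-*ᴹ (k ∷ ks) M≈XA = foldl-step-*ᴹ ks (≈ᴹ-trans (step-cong k M≈XA) (step-*ᴹ _ _ k))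

    ⊗≈*ᴹ-I⊗ : ∀ X → (X ⊗ Y) ≈ᴹ (X *ᴹ (I ⊗ Y))
    ⊗≈*ᴹ-I⊗ X = foldl-step-*ᴹ (allFin n) (≈ᴹ-sym (*ᴹ-identityʳ X))

    module _ (Y-sut : StrictlyUpperTriangular Y) where

      onlyRow-square : ∀ k → (onlyRow k *ᴹ onlyRow k) ≈ᴹ 0ᴹ
      onlyRow-square k = onlyRow-*ᴹ-zero k Y*onlyRow≈0
        where
        Y*onlyRow≈0 : ∀ j s → Y k j * onlyRow k j s ≈ 0#
        Y*onlyRow≈0 j s with <-cmp j k
        ... | tri≈ _ ≡.refl _ = trans (*-congʳ (Y-sut k k (ℕₚ.<-irrefl ≡.refl))) (zeroˡ _)
        ... | tri< _ j≢k _    = trans (*-congˡ (onlyRow-off s j≢k)) (zeroʳ _)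
        ... | tri> _ j≢k _    = trans (*-congˡ (onlyRow-off s j≢k)) (zeroʳ _)

      onlyRow-*ᴹ-firstRows : ∀ k → (onlyRow k *ᴹ firstRows (toℕ k)) ≈ᴹ 0ᴹ
      onlyRow-*ᴹ-firstRows k = onlyRow-*ᴹ-zero k Y*firstRows≈0
        where
        Y*firstRows≈0 : ∀ j s → Y k j * firstRows (toℕ k) j s ≈ 0#
        Y*firstRows≈0 j s with <-cmp j k
        ... | tri< j<k _ _ = trans (*-congʳ (Y-sut k j (ℕₚ.<-asym j<k))) (zeroˡ _)
        ... | tri≈ j≮k _ _ = trans (*-congˡ (firstRows-above j s j≮k)) (zeroʳ _)
        ... | tri> j≮k _ _ = trans (*-congˡ (firstRows-above j s j≮k)) (zeroʳ _)

      step-inverse : ∀ {t M} k → toℕ k ≡ t → IsInverse (I -ᴹ firstRows t) M → IsInverse (I -ᴹ firstRows (suc t)) (step Y M k)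
      step-inverse k ≡.refl M⁻¹ =
        IsInverse-resp-≈ᴹ factorisation (≈ᴹ-sym (step≈*ᴹ[I+onlyRow] _ k))
          (IsInverse-*ᴹ M⁻¹ (I-E-inverse-I+E (onlyRow-square k)))
        where
        factorisation : ((I -ᴹ onlyRow k) *ᴹ (I -ᴹ firstRows (toℕ k))) ≈ᴹ (I -ᴹ firstRows (suc (toℕ k)))
        factorisation = ≈ᴹ-trans ([I-E][I-D]≈I-[D+E] (onlyRow-*ᴹ-firstRows k))
                                 (λ r s → +-congˡ (-‿cong (sym (firstRows-suc k r s))))

      steps-inverse : ∀ {m} t (f : Fin m → Fin n) → (∀ i → toℕ (f i) ≡ t ℕ.+ toℕ i) → ∀ {M} →
                      IsInverse (I -ᴹ firstRows t) M → IsInverse (I -ᴹ firstRows (t ℕ.+ m)) (foldl (step Y) M (tabulate f))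
      steps-inverse {ℕ.zero} t f _ M⁻¹ rewrite ℕₚ.+-identityʳ t = M⁻¹
      steps-inverse {suc m}  t f f≡ M⁻¹ rewrite ℕₚ.+-suc t m =
        steps-inverse (suc t) (f ∘ Fin.suc) (λ i → ≡.trans (f≡ (Fin.suc i)) (ℕₚ.+-suc t (toℕ i)))
          (step-inverse (f Fin.zero) (≡.trans (f≡ Fin.zero) (ℕₚ.+-identityʳ t)) M⁻¹)

      I⊗-inverse : IsInverse (I -ᴹ Y) (I ⊗ Y)
      I⊗-inverse =
        IsInverse-resp-≈ᴹ (λ r s → +-congˡ (-‿cong (firstRows-all r s))) ≈ᴹ-refl
          (steps-inverse 0 id (λ _ → ≡.refl) I-inverse-I-firstRows₀)
        where
        I-inverse-I-firstRows₀ : IsInverse (I -ᴹ firstRows 0) I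
        I-inverse-I-firstRows₀ =
          IsInverse-resp-≈ᴹ (λ r s → sym (x-0≈x (firstRows-zero r s))) ≈ᴹ-refl (*ᴹ-identityˡ I , *ᴹ-identityˡ I)

mainTheorem5 : ∀ {c ℓ : Level} (F : Field c ℓ) (n : ℕ) →
    let open Matrices F in
    (X Y : Matrix n) → StrictlyUpperTriangular Y →
    Σ (Matrix n) (λ Z → IsInverse (I -ᴹ Y) Z)
      × (∀ Z → IsInverse (I -ᴹ Y) Z → (X ⊗ Y) ≈ᴹ (X *ᴹ Z))
mainTheorem5 F n X Y Y-sut =
  (I ⊗ Y , I⊗-inverse Y Y-sut) ,
  λ Z Z-inverse → ≈ᴹ-trans (⊗≈*ᴹ-I⊗ Y X) (*ᴹ-cong ≈ᴹ-refl (inverse-unique (I⊗-inverse Y Y-sut) Z-inverse))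
  where
  open Matrices F
  open MatrixProperties F
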